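{- Let $G=(V,E)$ be a finite undirected graph. The algorithm FIND\_MAX-CLIQUE described below, on input $G$, outputs a maximum clique of $G$.
   Context: For $v\in V$, $N_G(v)$ is the neighbor set of $v$, and $v\leftrightarrow_G u$ means $N_G(v)\cup\{v\}=N_G(u)\cup\{u\}$ (an equivalence relation whose classes are called closed neighborhoods). For a partition $\mathcal C'$ of $V$ and $v\in V$, $\mathcal C'[v]$ denotes the unique part of $\mathcal C'$ containing $v$. Algorithm FIND\_MAX-CLIQUE on input $G$: (1) set $U=V$, $\mathcal C'=\emptyset$; (2)–(5) while $U\neq\emptyset$: pick $v\in U$, let $C'=\{u\in U: u\leftrightarrow_G v\}$, add $C'$ to $\mathcal C'$, and set $U=U\setminus C'$; (6) let $G'=(V',E')$ be an induced subgraph of $G$ containing exactly one vertex from each set $C'\in\mathcal C'$; (7) by exhaustive search, find a clique $S$ of $G'$ maximizing $|\bigcup_{v'\in S}\mathcal C'[v']|$; (8) output $Q=\bigcup_{v'\in S}\mathcal C'[v']$. -}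

module Defs where

open import Data.Nat using (ℕ; _≤_)
open import Data.Bool using (Bool; true; false; _∧_; _∨_; if_then_else_)
open import Data.Fin using (Fin; _≟_)
open import Data.Fin.Subset using (Subset; _∈_; _⊆_; _∩_; _─_; ⊥; ⊤; ∣_∣)
open import Data.Vec using (tabulate; lookup)
import Data.Vec.Properties as VecP
import Data.Bool.Properties as BoolP
open import Data.List using (List; []; _∷_; allFin)
open import Data.Bool.ListAction using (any)
open import Data.List.Membership.Propositional using () renaming (_∈_ to _∈ᴸ_)
open import Relation.Nullary using (¬_)
open import Relation.Nullary.Decidable using (⌊_⌋)
open import Relation.Binary.PropositionalEquality using (_≡_)
open import Data.Product using (_×_)

-- A finite simple undirected graph on the vertex set V = Fin n,
-- given by a Boolean adjacency function (E = {{u,v} | adj u v ≡ true}).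
record Graph (n : ℕ) : Set where
  field
    adj   : Fin n → Fin n → Bool
    sym   : ∀ u v → adj u v ≡ adj v u
    irrefl : ∀ v → adj v v ≡ false
open Graph public

module _ {n : ℕ} (G : Graph n) where

  closedNbhd : Fin n → Subset n
  closedNbhd v = tabulate λ w → ⌊ w ≟ v ⌋ ∨ adj G v w

  _↔_ : Fin n → Fin n → Bool
  v ↔ u = ⌊ VecP.≡-dec BoolP._≟_ (closedNbhd v) (closedNbhd u) ⌋

  classIn : Subset n → Fin n → Subset n
  classIn U v = U ∩ tabulate (λ u → u ↔ v)

  -- Steps (1)-(5) of FIND_MAX-CLIQUE: `Loop U 𝒞` means that the while-loop,
  -- started with the current set U, can (for some choices of v) terminate
  -- having added exactly the sets of 𝒞 (in order).
  data Loop : Subset n → List (Subset n) → Set where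
    done : Loop ⊥ []
    step : ∀ {U 𝒞} (v : Fin n) → v ∈ U →
           Loop (U ─ classIn U v) 𝒞 → Loop U (classIn U v ∷ 𝒞)

  IsClique : Subset n → Set
  IsClique K = ∀ u v → u ∈ K → v ∈ K → ¬ (u ≡ v) → adj G u v ≡ true

  IsMaxClique : Subset n → Set
  IsMaxClique Q = IsClique Q × (∀ K → IsClique K → ∣ K ∣ ≤ ∣ Q ∣)

-- 𝒞'[v]: the (first, hence for a partition the unique) part of 𝒞' containing v
partOf : {n : ℕ} → List (Subset n) → Fin n → Subset n
partOf []      v = ⊥
partOf (C ∷ 𝒞) v = if lookup C v then C else partOf 𝒞 v

unionParts : {n : ℕ} → List (Subset n) → Subset n → Subset n
unionParts {n} 𝒞 S =
  tabulate λ w → any (λ v → lookup S v ∧ lookup (partOf 𝒞 v) w) (allFin n)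

-- Step (6): V' contains exactly one vertex from each set C' ∈ 𝒞'
-- (𝒞' partitions V, so V' is a set of representatives).
IsRepSet : {n : ℕ} → List (Subset n) → Subset n → Set
IsRepSet 𝒞 V' = ∀ C → C ∈ᴸ 𝒞 → ∣ V' ∩ C ∣ ≡ 1

-- Vertices with the same closed neighbourhood ("closed twins") are interchangeable:
-- if u ~ u' and v ~ v', then u is equal or adjacent to v iff u' is equal or adjacent
-- to v'. Steps (1)-(5) partition V into the twin classes, so two classes are either
-- completely joined or completely non-adjacent, and each class is a clique. Hence the
-- union of the classes of a clique of representatives is a clique, and every clique K
-- lies inside the union over the clique of representatives V' ∩ ⋃K of the classes
-- meeting K; maximality of the union over S then gives |K| ≤ |⋃S|.
module Submission where

open import Defs hiding (sym)
open import Data.Nat using (ℕ; _≤_; suc)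
open import Data.List using (List; _∷_; allFin)
open import Data.Fin.Subset using (Subset; _⊆_; ⊤; ∣_∣; _∈_; _∉_; _∩_; Nonempty)

open import Data.Bool using (Bool; true; false; T; _∨_)
open import Data.Bool.Properties using (T-≡; T-∧; ∨-zeroʳ)
open import Data.Fin using (Fin; _≟_)
open import Data.Fin.Subset.Properties
  using (_∈?_; ∉⊥; ∈⊤; nonempty?; Empty-unique; ∣⊥∣≡0; x∈p∩q⁺; x∈p∩q⁻; p∩q⊆p; p∩q⊆q;
         x∈p∧x∉q⇒x∈p─q; p⊆q⇒∣p∣≤∣q∣)
open import Data.List.Membership.Propositional using (lose) renaming (_∈_ to _∈ᴸ_)
open import Data.List.Membership.Propositional.Properties using (∈-allFin)
open import Data.List.Relation.Unary.Any using (here; there; satisfied)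
open import Data.List.Relation.Unary.Any.Properties using (any⁺; any⁻)
open import Data.Nat.Properties using (≤-trans)
open import Data.Product using (_×_; _,_; proj₂; ∃-syntax)
open import Data.Sum using (_⊎_; inj₁; inj₂)
open import Data.Vec using (tabulate; lookup)
open import Data.Vec.Properties using (lookup∘tabulate; []=⇒lookup; lookup⇒[]=)
open import Function using (_∘_; Equivalence)
open import Relation.Nullary using (yes; no; contradiction)
open import Relation.Nullary.Decidable using (toWitness; fromWitness)
open import Relation.Binary.PropositionalEquality
  using (_≡_; refl; sym; trans; cong; subst)

open Equivalence using (to; from)

private
  variable
    n m : ℕ

∈⇒T : {p : Subset n} {x : Fin n} → x ∈ p → T (lookup p x)
∈⇒T x∈p = from T-≡ ([]=⇒lookup x∈p)

T⇒∈ : {p : Subset n} {x : Fin n} → T (lookup p x) → x ∈ p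
T⇒∈ t = lookup⇒[]= _ _ (to T-≡ t)

x∈tabulate⁻ : {f : Fin n → Bool} {x : Fin n} → x ∈ tabulate f → f x ≡ true
x∈tabulate⁻ {f = f} {x} x∈ = trans (sym (lookup∘tabulate f x)) ([]=⇒lookup x∈)

x∈tabulate⁺ : {f : Fin n → Bool} {x : Fin n} → f x ≡ true → x ∈ tabulate f
x∈tabulate⁺ {f = f} {x} fx = lookup⇒[]= x _ (trans (lookup∘tabulate f x) fx)

∣p∣≡suc⇒Nonempty : {p : Subset n} → ∣ p ∣ ≡ suc m → Nonempty p
∣p∣≡suc⇒Nonempty {n} {p = p} ∣p∣≡suc with nonempty? p
... | yes p≢∅ = p≢∅
... | no  p≡∅ =
  contradiction (trans (sym (∣⊥∣≡0 n)) (trans (cong ∣_∣ (sym (Empty-unique p≡∅))) ∣p∣≡suc)) λ ()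

partOf-here : (𝒞 : List (Subset n)) {C : Subset n} {v : Fin n} →
              v ∈ C → partOf (C ∷ 𝒞) v ≡ C
partOf-here _ v∈C rewrite []=⇒lookup v∈C = refl

partOf-there : (𝒞 : List (Subset n)) {C : Subset n} {v : Fin n} →
               v ∉ C → partOf (C ∷ 𝒞) v ≡ partOf 𝒞 v
partOf-there _ {C} {v} v∉C with lookup C v in C[v]
... | true  = contradiction (lookup⇒[]= v C C[v]) v∉C
... | false = refl

∈-unionParts⁻ : (𝒞 : List (Subset n)) {S : Subset n} {w : Fin n} →
                w ∈ unionParts 𝒞 S → ∃[ s ] s ∈ S × w ∈ partOf 𝒞 s
∈-unionParts⁻ {n} 𝒞 {S} w∈ with satisfied (any⁻ _ (allFin n) (from T-≡ (x∈tabulate⁻ w∈)))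
... | s , t with to (T-∧ {lookup S s}) t
...   | s∈S , w∈part = s , T⇒∈ s∈S , T⇒∈ w∈part

∈-unionParts⁺ : (𝒞 : List (Subset n)) {S : Subset n} {s w : Fin n} →
                s ∈ S → w ∈ partOf 𝒞 s → w ∈ unionParts 𝒞 S
∈-unionParts⁺ _ {S} {s} s∈S w∈part =
  x∈tabulate⁺ (to T-≡ (any⁺ _ (lose (∈-allFin s) (from (T-∧ {lookup S s}) (∈⇒T s∈S , ∈⇒T w∈part)))))

module _ (G : Graph n) where

  Twins : Fin n → Fin n → Set
  Twins u v = closedNbhd G u ≡ closedNbhd G v

  ↔⇒Twins : {u v : Fin n} → (_↔_ G u v) ≡ true → Twins u v
  ↔⇒Twins u↔v = toWitness (from T-≡ u↔v)

  Twins⇒↔ : {u v : Fin n} → Twins u v → (_↔_ G u v) ≡ true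
  Twins⇒↔ u~v = to T-≡ (fromWitness u~v)

  ∈-closedNbhd⁻ : {v w : Fin n} → w ∈ closedNbhd G v → w ≡ v ⊎ adj G v w ≡ true
  ∈-closedNbhd⁻ {v} {w} w∈ with w ≟ v | x∈tabulate⁻ w∈
  ... | yes w≡v | _   = inj₁ w≡v
  ... | no  _   | vw = inj₂ vw

  ∈-closedNbhd⁺ : {v w : Fin n} → w ≡ v ⊎ adj G v w ≡ true → w ∈ closedNbhd G v
  ∈-closedNbhd⁺ {v} (inj₁ refl) =
    x∈tabulate⁺ (cong (_∨ adj G v v) (to T-≡ (fromWitness {a? = v ≟ v} refl)))
  ∈-closedNbhd⁺ (inj₂ vw) = x∈tabulate⁺ (trans (cong (_ ∨_) vw) (∨-zeroʳ _))

  ∈-closedNbhd-refl : {v : Fin n} → v ∈ closedNbhd G v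
  ∈-closedNbhd-refl = ∈-closedNbhd⁺ (inj₁ refl)

  ∈-closedNbhd-sym : {v w : Fin n} → w ∈ closedNbhd G v → v ∈ closedNbhd G w
  ∈-closedNbhd-sym {v} {w} w∈ with ∈-closedNbhd⁻ w∈
  ... | inj₁ refl = ∈-closedNbhd-refl
  ... | inj₂ vw   = ∈-closedNbhd⁺ (inj₂ (trans (Graph.sym G w v) vw))

  ∈-closedNbhd-resp-Twins : {u u' v v' : Fin n} → Twins u u' → Twins v v' →
                            u ∈ closedNbhd G v → u' ∈ closedNbhd G v'
  ∈-closedNbhd-resp-Twins {u = u} {v' = v'} u~u' v~v' u∈ =
    ∈-closedNbhd-sym (subst (v' ∈_) u~u' (∈-closedNbhd-sym (subst (u ∈_) v~v' u∈)))

  clique⇒∈-closedNbhd : {K : Subset n} {u v : Fin n} →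
                        IsClique G K → u ∈ K → v ∈ K → u ∈ closedNbhd G v
  clique⇒∈-closedNbhd {u = u} {v} K-clique u∈K v∈K with u ≟ v
  ... | yes refl = ∈-closedNbhd-refl
  ... | no  u≢v  = ∈-closedNbhd⁺ (inj₂ (K-clique v u v∈K u∈K (u≢v ∘ sym)))

  ∈-closedNbhd⇒clique : {K : Subset n} →
                        (∀ {u v} → u ∈ K → v ∈ K → u ∈ closedNbhd G v) → IsClique G K
  ∈-closedNbhd⇒clique closed u v u∈K v∈K u≢v with ∈-closedNbhd⁻ (closed v∈K u∈K)
  ... | inj₁ v≡u = contradiction (sym v≡u) u≢v
  ... | inj₂ uv  = uv

  clique-antimono : {K L : Subset n} → K ⊆ L → IsClique G L → IsClique G K
  clique-antimono K⊆L L-clique u v u∈K v∈K = L-clique u v (K⊆L u∈K) (K⊆L v∈K)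

  ∈-classIn⁻ : {U : Subset n} {u w : Fin n} → w ∈ classIn G U u → w ∈ U × Twins w u
  ∈-classIn⁻ {U} w∈ with x∈p∩q⁻ U _ w∈
  ... | w∈U , w↔u = w∈U , ↔⇒Twins (x∈tabulate⁻ w↔u)

  ∈-classIn⁺ : {U : Subset n} {u w : Fin n} → w ∈ U → Twins w u → w ∈ classIn G U u
  ∈-classIn⁺ w∈U w~u = x∈p∩q⁺ (w∈U , x∈tabulate⁺ (Twins⇒↔ w~u))

  record IsClosedNbhdPartition (𝒞 : List (Subset n)) : Set where
    field
      partOf-Twins : {v w : Fin n} → w ∈ partOf 𝒞 v → Twins v w
      Twins-partOf : {v w : Fin n} → Twins v w → w ∈ partOf 𝒞 v
      partOf-∈    : (v : Fin n) → partOf 𝒞 v ∈ᴸ 𝒞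

  loop-partOf-Twins : {U : Subset n} {𝒞 : List (Subset n)} {v w : Fin n} →
                      Loop G U 𝒞 → w ∈ partOf 𝒞 v → Twins v w
  loop-partOf-Twins done w∈ = contradiction w∈ ∉⊥
  loop-partOf-Twins {v = v} {w} (step {U} {𝒞} u _ loop) w∈ with v ∈? classIn G U u
  ... | yes v∈C = trans (proj₂ (∈-classIn⁻ v∈C))
                        (sym (proj₂ (∈-classIn⁻ (subst (w ∈_) (partOf-here 𝒞 v∈C) w∈))))
  ... | no  v∉C = loop-partOf-Twins loop (subst (w ∈_) (partOf-there 𝒞 v∉C) w∈)

  loop-Twins-partOf : {U : Subset n} {𝒞 : List (Subset n)} {v w : Fin n} →
                      Loop G U 𝒞 → v ∈ U → w ∈ U → Twins v w → w ∈ partOf 𝒞 v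
  loop-Twins-partOf done v∈U _ _ = contradiction v∈U ∉⊥
  loop-Twins-partOf {v = v} {w} (step {U} {𝒞} u _ loop) v∈U w∈U v~w with v ∈? classIn G U u
  ... | yes v∈C = subst (w ∈_) (sym (partOf-here 𝒞 v∈C))
                        (∈-classIn⁺ w∈U (trans (sym v~w) (proj₂ (∈-classIn⁻ v∈C))))
  ... | no  v∉C = subst (w ∈_) (sym (partOf-there 𝒞 v∉C))
                        (loop-Twins-partOf loop (x∈p∧x∉q⇒x∈p─q v∈U v∉C) (x∈p∧x∉q⇒x∈p─q w∈U w∉C) v~w)
    where
    w∉C : w ∉ classIn G U u
    w∉C w∈C = v∉C (∈-classIn⁺ v∈U (trans v~w (proj₂ (∈-classIn⁻ w∈C))))

  loop-partOf-∈ : {U : Subset n} {𝒞 : List (Subset n)} {v : Fin n} →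
                  Loop G U 𝒞 → v ∈ U → partOf 𝒞 v ∈ᴸ 𝒞
  loop-partOf-∈ done v∈U = contradiction v∈U ∉⊥
  loop-partOf-∈ {v = v} (step {U} {𝒞} u _ loop) v∈U with v ∈? classIn G U u
  ... | yes v∈C = here (partOf-here 𝒞 v∈C)
  ... | no  v∉C = there (subst (_∈ᴸ _) (sym (partOf-there 𝒞 v∉C))
                               (loop-partOf-∈ loop (x∈p∧x∉q⇒x∈p─q v∈U v∉C)))

  loop-isClosedNbhdPartition : {𝒞 : List (Subset n)} → Loop G ⊤ 𝒞 → IsClosedNbhdPartition 𝒞
  loop-isClosedNbhdPartition loop = record
    { partOf-Twins = loop-partOf-Twins loop
    ; Twins-partOf = loop-Twins-partOf loop ∈⊤ ∈⊤
    ; partOf-∈    = λ v → loop-partOf-∈ loop ∈⊤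
    }

  module _ {𝒞 : List (Subset n)} (P : IsClosedNbhdPartition 𝒞) where
    open IsClosedNbhdPartition P

    unionParts-clique : {X : Subset n} → IsClique G X → IsClique G (unionParts 𝒞 X)
    unionParts-clique {X} X-clique = ∈-closedNbhd⇒clique closed
      where
      closed : ∀ {u w} → u ∈ unionParts 𝒞 X → w ∈ unionParts 𝒞 X → u ∈ closedNbhd G w
      closed u∈ w∈ with ∈-unionParts⁻ 𝒞 u∈ | ∈-unionParts⁻ 𝒞 w∈
      ... | s , s∈X , u∈part | t , t∈X , w∈part =
        ∈-closedNbhd-resp-Twins (partOf-Twins u∈part) (partOf-Twins w∈part)
                                (clique⇒∈-closedNbhd X-clique s∈X t∈X)

    ⊆-unionParts-representatives : {V' K : Subset n} → IsRepSet 𝒞 V' →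
                                   K ⊆ unionParts 𝒞 (V' ∩ unionParts 𝒞 K)
    ⊆-unionParts-representatives {V'} reps {k} k∈K
      with ∣p∣≡suc⇒Nonempty (reps _ (partOf-∈ k))
    ... | r , r∈V'∩part with x∈p∩q⁻ V' _ r∈V'∩part
    ... | r∈V' , r∈part =
      ∈-unionParts⁺ 𝒞 (x∈p∩q⁺ (r∈V' , ∈-unionParts⁺ 𝒞 k∈K r∈part))
                    (Twins-partOf (sym (partOf-Twins r∈part)))

theorem1 : (n : ℕ) (G : Graph n) (𝒞 : List (Subset n)) →
           Loop G ⊤ 𝒞 →
           (V' : Subset n) → IsRepSet 𝒞 V' →
           (S : Subset n) → S ⊆ V' → IsClique G S →
           (∀ T → T ⊆ V' → IsClique G T →
                  ∣ unionParts 𝒞 T ∣ ≤ ∣ unionParts 𝒞 S ∣) →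
           IsMaxClique G (unionParts 𝒞 S)
theorem1 n G 𝒞 loop V' reps S _ S-clique S-best = unionParts-clique G P S-clique , maximum
  where
  P : IsClosedNbhdPartition G 𝒞
  P = loop-isClosedNbhdPartition G loop

  maximum : ∀ K → IsClique G K → ∣ K ∣ ≤ ∣ unionParts 𝒞 S ∣
  maximum K K-clique =
    ≤-trans (p⊆q⇒∣p∣≤∣q∣ (⊆-unionParts-representatives G P {V'} {K} reps))
            (S-best R (p∩q⊆p V' _) (clique-antimono G (p∩q⊆q V' _) (unionParts-clique G P K-clique)))
    where
    R : Subset n
    R = V' ∩ unionParts 𝒞 K
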